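{- Let $\lambda$ be any partition, $z$ a content with $|z|=|\lambda|$, and $F,S$ fillings of shape $\lambda$ and content $z$. If some column of $F$ contains a repeated value, then $R(F,S)=0$.
   Context: Fix $n\ge 2$. A partition $\lambda$ is identified with its Young diagram with column lengths $\zeta_1\ge\cdots\ge\zeta_{\lambda_1}$; $(r,c)$ is the box in row $r$, column $c$. A filling of shape $\lambda$ assigns a value in $\{1,\dots,n\}$ to each box; its content counts occurrences of each value. Same row content: for each row, the multisets of entries of that row agree. $\mathfrak{S}_\lambda=\prod_c\mathfrak{S}_{\zeta_c}$ acts by $F_{\underline\pi}(r,c)=F(\pi_c(r),c)$, $\mathrm{sgn}(\underline\pi)=\prod_c\mathrm{sgn}(\pi_c)$. $R(F,S)=\sum\mathrm{sgn}(\underline\pi)$ over all $\underline\pi\in\mathfrak{S}_\lambda$ such that $F_{\underline\pi}$ has the same row content as $S$. -}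

module Defs where

open import Data.Nat using (ℕ; zero; suc; _≤_; _<_; _<?_; _⊔_)
open import Data.Nat.Properties using () renaming (_≟_ to _≟ℕ_)
open import Data.Fin using (Fin; zero; suc; fromℕ<; toℕ) renaming (_<?_ to _<ᶠ?_) renaming (_<_ to _<ᶠ_)
open import Data.Fin.Properties using (all?; any?) renaming (_≟_ to _≟ᶠ_)
open import Data.List using (List; []; _∷_; map; concatMap; filter; length; allFin; foldr)
open import Data.Integer using (ℤ; +_; -_; _*_; _+_)
open import Data.Product using (_×_; _,_; Σ)
open import Data.Maybe using (Maybe; just; nothing)
open import Data.Maybe.Properties using (≡-dec)
open import Relation.Binary.PropositionalEquality using (_≡_)
open import Relation.Nullary using (Dec; yes; no; ¬_)
open import Relation.Nullary.Decidable using (⌊_⌋; _×-dec_; _→-dec_)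
open import Data.Bool using (if_then_else_)

Σℕ : {m : ℕ} → (Fin m → ℕ) → ℕ
Σℕ {m} f = foldr (λ i acc → f i Data.Nat.+ acc) 0 (allFin m)

-- A partition λ given by its column lengths ζ₁ ≥ ζ₂ ≥ … ≥ ζ_k > 0  (k = λ₁).
record Partition : Set where
  field
    ncols    : ℕ
    col      : Fin ncols → ℕ
    antitone : ∀ (i j : Fin ncols) → i Data.Fin.≤ j → col j ≤ col i
    positive : ∀ (i : Fin ncols) → 1 ≤ col i
open Partition public

size : Partition → ℕ
size λ' = Σℕ (col λ')

height : Partition → ℕ
height λ' = foldr _⊔_ 0 (map (col λ') (allFin (ncols λ')))

-- A filling of shape λ with values in {1..n} (encoded as Fin n):
-- F c r is the entry of box (r, c)  (row r, column c; r < ζ_c).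
Filling : ℕ → Partition → Set
Filling n λ' = (c : Fin (ncols λ')) → Fin (col λ' c) → Fin n

-- A content: multiplicity of each value; |z| = sum of multiplicities.
Content : ℕ → Set
Content n = Fin n → ℕ

∣_∣ᶜ : {n : ℕ} → Content n → ℕ
∣ z ∣ᶜ = Σℕ z

countVal : {n : ℕ} {λ' : Partition} → Filling n λ' → Fin n → ℕ
countVal {n} {λ'} F v =
  Σℕ (λ c → length (filter (λ r → F c r ≟ᶠ v) (allFin (col λ' c))))

HasContent : {n : ℕ} {λ' : Partition} → Filling n λ' → Content n → Set
HasContent {n} {λ'} F z = ∀ v → countVal {n} {λ'} F v ≡ z v

entry : {n : ℕ} {λ' : Partition} → Filling n λ' → ℕ → Fin (ncols λ') → Maybe (Fin n)
entry {n} {λ'} F r c with r <? col λ' c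
... | yes p = just (F c (fromℕ< p))
... | no _  = nothing

rowCount : {n : ℕ} {λ' : Partition} → Filling n λ' → ℕ → Fin n → ℕ
rowCount {n} {λ'} F r v =
  length (filter (λ c → ≡-dec _≟ᶠ_ (entry {n} {λ'} F r c) (just v)) (allFin (ncols λ')))

-- Same row content: for each row, the multisets of entries agree
-- (multiset equality expressed as equality of multiplicities of every value).
SameRowContent : {n : ℕ} {λ' : Partition} → Filling n λ' → Filling n λ' → Set
SameRowContent {n} {λ'} F S =
  ∀ (r : Fin (height λ')) (v : Fin n) → rowCount {n} {λ'} F (toℕ r) v ≡ rowCount {n} {λ'} S (toℕ r) v

sameRowContent? : {n : ℕ} {λ' : Partition} (F S : Filling n λ') → Dec (SameRowContent F S)
sameRowContent? {n} {λ'} F S =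
  all? (λ r → all? (λ v → rowCount {n} {λ'} F (toℕ r) v ≟ℕ rowCount {n} {λ'} S (toℕ r) v))

-- All permutations of Fin m, as bijective (equivalently injective) functions Fin m → Fin m.
allFuns : (a b : ℕ) → List (Fin a → Fin b)
allFuns zero    b = (λ ()) ∷ []
allFuns (suc a) b = concatMap (λ f → map (λ x → cons x f) (allFin b)) (allFuns a b)
  where
    cons : Fin b → (Fin a → Fin b) → Fin (suc a) → Fin b
    cons x f zero    = x
    cons x f (suc i) = f i

IsInjective : {m : ℕ} → (Fin m → Fin m) → Set
IsInjective {m} f = ∀ (i j : Fin m) → f i ≡ f j → i ≡ j

injective? : {m : ℕ} (f : Fin m → Fin m) → Dec (IsInjective f)
injective? f = all? (λ i → all? (λ j → (f i ≟ᶠ f j) →-dec (i ≟ᶠ j)))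

perms : (m : ℕ) → List (Fin m → Fin m)
perms m = filter injective? (allFuns m m)

inversions : {m : ℕ} → (Fin m → Fin m) → ℕ
inversions {m} f =
  Σℕ (λ i → length (filter (λ j → (i <ᶠ? j) ×-dec (f j <ᶠ? f i)) (allFin m)))

negPow : ℕ → ℤ
negPow zero    = + 1
negPow (suc k) = - negPow k

sgn : {m : ℕ} → (Fin m → Fin m) → ℤ
sgn f = negPow (inversions f)

-- The group 𝔖_λ = ∏_c 𝔖_{ζ_c}: tuples of permutations, one per column.
ColPerm : Partition → Set
ColPerm λ' = (c : Fin (ncols λ')) → Fin (col λ' c) → Fin (col λ' c)

tuples : (k : ℕ) (ζ : Fin k → ℕ) → List ((c : Fin k) → Fin (ζ c) → Fin (ζ c))
tuples zero    ζ = (λ ()) ∷ []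
tuples (suc k) ζ =
  concatMap (λ p → map (λ t → consD p t) (tuples k (λ c → ζ (suc c)))) (perms (ζ zero))
  where
    consD : (Fin (ζ zero) → Fin (ζ zero)) → ((c : Fin k) → Fin (ζ (suc c)) → Fin (ζ (suc c)))
          → (c : Fin (suc k)) → Fin (ζ c) → Fin (ζ c)
    consD p t zero    = p
    consD p t (suc c) = t c

allColPerms : (λ' : Partition) → List (ColPerm λ')
allColPerms λ' = tuples (ncols λ') (col λ')

sgnᶜ : {λ' : Partition} → ColPerm λ' → ℤ
sgnᶜ {λ'} π = foldr (λ c acc → sgn (π c) * acc) (+ 1) (allFin (ncols λ'))

act : {n : ℕ} {λ' : Partition} → Filling n λ' → ColPerm λ' → Filling n λ'
act F π c r = F c (π c r)

R : {n : ℕ} {λ' : Partition} → Filling n λ' → Filling n λ' → ℤ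
R {n} {λ'} F S =
  foldr (λ π acc → (if ⌊ sameRowContent? {n} {λ'} (act {n} {λ'} F π) S ⌋ then sgnᶜ {λ'} π else + 0) + acc)
        (+ 0) (allColPerms λ')

HasRepeatInColumn : {n : ℕ} {λ' : Partition} → Filling n λ' → Set
HasRepeatInColumn {n} {λ'} F =
  Σ (Fin (ncols λ')) λ c → Σ (Fin (col λ' c)) λ i → Σ (Fin (col λ' c)) λ j →
    (¬ (i ≡ j)) × (F c i ≡ F c j)

-- Let τ transpose two rows whose entries agree in column c of F. Replacing the c-th
-- component π_c of π ∈ 𝔖_λ by τ ∘ π_c leaves F_π unchanged but flips sgn(π). This
-- reindexing is a bijection of 𝔖_λ, so R(F,S) equals its own negative and vanishes.
-- The sign flip is the classical one: an adjacent transposition changes the inversion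
-- count by exactly one, and every transposition is a conjugate of adjacent ones.
module Submission where

open import Level using (Level; _⊔_)
import Algebra.Properties.CommutativeMonoid.Sum as CommutativeMonoidSum
import Algebra.Properties.Monoid.Sum as MonoidSum
open import Data.Bool using (true; false; if_then_else_)
open import Data.Empty using (⊥-elim)
open import Data.Fin using (Fin; zero; suc; toℕ; fromℕ<; punchOut)
  renaming (_<_ to _<ᶠ_; _<?_ to _<ᶠ?_)
import Data.Fin.Permutation as Permutation
open import Data.Fin.Permutation.Components using (transpose; transpose-inverse)
open import Data.Fin.Properties
  using (_≟_; 0≢1+n; any?; pigeonhole; punchOut-injective; suc-injective; toℕ-injective; toℕ-fromℕ<; toℕ<n; <-cmp)
open import Data.Integer as ℤ using (ℤ; +_; -_; +[1+_]; -[1+_])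
import Data.Integer.Properties as ℤₚ
open import Data.List using (List; []; _∷_; _++_; map; concatMap; filter; foldr; length; tabulate; allFin)
open import Data.List.Relation.Unary.All as All using (All; []; _∷_)
import Data.List.Relation.Unary.All.Properties as Allₚ
open import Data.Maybe using (just)
open import Data.Maybe.Properties using (≡-dec)
open import Data.Nat as ℕ using (ℕ; zero; suc; _+_; _*_; _≤_; _<_; _∸_; s≤s)
import Data.Nat.Properties as ℕₚ
open import Data.Nat.Tactic.RingSolver using (solve-∀)
open import Data.Product using (∃; _,_; proj₁; proj₂)
import Data.Vec.Functional as Vector
open import Function using (_∘_; id; _⇔_; mk⇔)
import Function.Properties.Equivalence as ⇔
open import Relation.Binary using (Rel; tri<; tri≈; tri>; _Preserves_⟶_)
open import Relation.Binary.PropositionalEquality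
open import Relation.Nullary using (Dec; yes; no; does; ¬_)
open import Relation.Nullary.Decidable using (dec-true; dec-false; does-⇔; isYes≗does; _×-dec_; ⌊_⌋)

open import Defs

private
  variable
    a b ℓ ℓ₁ ℓ₂ ℓ₃ p q : Level
    A : Set a
    B : Set b
    C : Set ℓ
    k m m′ : ℕ

open CommutativeMonoidSum ℕₚ.+-0-commutativeMonoid using (sum; sum-cong-≗; ∑-distrib-+; sum-replicate-zero)
open CommutativeMonoidSum ℤₚ.+-0-commutativeMonoid using () renaming (sum to sumℤ; sum-permute to sumℤ-permute)
open MonoidSum ℤₚ.*-1-monoid using () renaming (sum to product; sum-cong-≗ to product-cong-≗)

𝟙 : {P : Set p} → Dec P → ℕ
𝟙 P? = if does P? then 1 else 0

𝟙-yes : {P : Set p} (P? : Dec P) → P → 𝟙 P? ≡ 1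
𝟙-yes P? x rewrite dec-true P? x = refl

𝟙-no : {P : Set p} (P? : Dec P) → ¬ P → 𝟙 P? ≡ 0
𝟙-no P? ¬x rewrite dec-false P? ¬x = refl

𝟙-⇔ : {P : Set p} {Q : Set q} → P ⇔ Q → (P? : Dec P) (Q? : Dec Q) → 𝟙 P? ≡ 𝟙 Q?
𝟙-⇔ P⇔Q P? Q? = cong (λ x → if x then 1 else 0) (does-⇔ P⇔Q P? Q?)

𝟙-× : {P : Set p} {Q : Set q} (P? : Dec P) (Q? : Dec Q) → 𝟙 (P? ×-dec Q?) ≡ 𝟙 P? * 𝟙 Q?
𝟙-× P? Q? with does P? | does Q?
... | true  | true  = refl
... | true  | false = refl
... | false | _     = refl

foldr-tabulate : (_∙_ : B → C → C) (e : C) (f : A → B) (g : Fin m → A) →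
  foldr (λ x → f x ∙_) e (tabulate g) ≡ Vector.foldr _∙_ e (f ∘ g)
foldr-tabulate {m = zero}  _∙_ e f g = refl
foldr-tabulate {m = suc m} _∙_ e f g = cong (f (g zero) ∙_) (foldr-tabulate _∙_ e f (g ∘ suc))

length-filter-tabulate : {P : A → Set p} (P? : ∀ x → Dec (P x)) (g : Fin m → A) →
  length (filter P? (tabulate g)) ≡ sum (𝟙 ∘ P? ∘ g)
length-filter-tabulate {m = zero}  P? g = refl
length-filter-tabulate {m = suc m} P? g with does (P? (g zero))
... | true  = cong suc (length-filter-tabulate P? (g ∘ suc))
... | false = length-filter-tabulate P? (g ∘ suc)

sum₂ : (Fin m → Fin m′ → ℕ) → ℕ
sum₂ F = sum λ i → sum (F i)

sum₂-cong : {F G : Fin m → Fin m′ → ℕ} → (∀ i j → F i j ≡ G i j) → sum₂ F ≡ sum₂ G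
sum₂-cong F≡G = sum-cong-≗ λ i → sum-cong-≗ (F≡G i)

sum₂-+ : (F G : Fin m → Fin m′ → ℕ) → sum₂ (λ i j → F i j + G i j) ≡ sum₂ F + sum₂ G
sum₂-+ {m} {m′} F G = trans (sum-cong-≗ λ i → ∑-distrib-+ {m′} (F i) (G i)) (∑-distrib-+ {m} _ _)

sum-𝟙*-unique : {P : Fin m → Set p} (P? : ∀ x → Dec (P x)) {q : Fin m} → P q → (∀ x → P x → x ≡ q) →
  (w : Fin m → ℕ) → sum (λ x → 𝟙 (P? x) * w x) ≡ w q
sum-𝟙*-unique {m = suc m} P? {zero} Pq unique w = begin
  𝟙 (P? zero) * w zero + sum (λ x → 𝟙 (P? (suc x)) * w (suc x))
    ≡⟨ cong₂ _+_ (cong (_* w zero) (𝟙-yes (P? zero) Pq))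
                 (sum-cong-≗ λ x → cong (_* w (suc x)) (𝟙-no (P? (suc x)) (0≢1+n ∘ sym ∘ unique (suc x)))) ⟩
  1 * w zero + sum {m} (λ _ → 0)
    ≡⟨ cong₂ _+_ (ℕₚ.*-identityˡ (w zero)) (sum-replicate-zero m) ⟩
  w zero + 0
    ≡⟨ ℕₚ.+-identityʳ (w zero) ⟩
  w zero ∎
  where open ≡-Reasoning
sum-𝟙*-unique {m = suc m} P? {suc q} Pq unique w
  rewrite 𝟙-no (P? zero) (0≢1+n ∘ unique zero)
  = sum-𝟙*-unique (P? ∘ suc) Pq (λ x Px → suc-injective (unique (suc x) Px)) (w ∘ suc)

inversions≡sum₂ : (f : Fin m → Fin m) → inversions f ≡ sum₂ λ i j → 𝟙 (i <ᶠ? j) * 𝟙 (f j <ᶠ? f i)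
inversions≡sum₂ {m} f = begin
  inversions f
    ≡⟨ foldr-tabulate _+_ 0 (λ i → length (filter (λ j → (i <ᶠ? j) ×-dec (f j <ᶠ? f i)) (allFin m))) id ⟩
  sum (λ i → length (filter (λ j → (i <ᶠ? j) ×-dec (f j <ᶠ? f i)) (allFin m)))
    ≡⟨ sum-cong-≗ (λ i → length-filter-tabulate (λ j → (i <ᶠ? j) ×-dec (f j <ᶠ? f i)) id) ⟩
  sum₂ (λ i j → 𝟙 ((i <ᶠ? j) ×-dec (f j <ᶠ? f i)))
    ≡⟨ sum₂-cong (λ i j → 𝟙-× (i <ᶠ? j) (f j <ᶠ? f i)) ⟩
  sum₂ (λ i j → 𝟙 (i <ᶠ? j) * 𝟙 (f j <ᶠ? f i)) ∎
  where open ≡-Reasoning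

sgn-cong : {f g : Fin m → Fin m} → f ≗ g → sgn f ≡ sgn g
sgn-cong {f = f} {g} f≗g = cong negPow (begin
  inversions f
    ≡⟨ inversions≡sum₂ f ⟩
  sum₂ (λ i j → 𝟙 (i <ᶠ? j) * 𝟙 (f j <ᶠ? f i))
    ≡⟨ sum₂-cong (λ i j → cong (λ x → 𝟙 (i <ᶠ? j) * x) (cong₂ (λ x y → 𝟙 (x <ᶠ? y)) (f≗g j) (f≗g i))) ⟩
  sum₂ (λ i j → 𝟙 (i <ᶠ? j) * 𝟙 (g j <ᶠ? g i))
    ≡⟨ inversions≡sum₂ g ⟨
  inversions g ∎)
  where open ≡-Reasoning

-- Transpositions

transpose-ij : (i j : Fin m) → transpose i j i ≡ j
transpose-ij i j rewrite dec-true (i ≟ i) refl = refl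

transpose-ji : (i j : Fin m) → transpose i j j ≡ i
transpose-ji i j with j ≟ i
... | yes refl = refl
... | no _ rewrite dec-true (j ≟ j) refl = refl

transpose-fix : (i j : Fin m) {x : Fin m} → x ≢ i → x ≢ j → transpose i j x ≡ x
transpose-fix i j {x} x≢i x≢j rewrite dec-false (x ≟ i) x≢i | dec-false (x ≟ j) x≢j = refl

transpose-comm : (i j : Fin m) → transpose i j ≗ transpose j i
transpose-comm i j x = go (x ≟ i) (x ≟ j)
  where
  go : Dec (x ≡ i) → Dec (x ≡ j) → transpose i j x ≡ transpose j i x
  go (yes refl) _          = trans (transpose-ij x j) (sym (transpose-ji j x))
  go (no _)     (yes refl) = trans (transpose-ji i x) (sym (transpose-ij x i))
  go (no x≢i)   (no x≢j)   = trans (transpose-fix i j x≢i x≢j) (sym (transpose-fix j i x≢j x≢i))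

transpose-involutive : (i j : Fin m) → transpose i j ∘ transpose i j ≗ id
transpose-involutive i j x = trans (cong (transpose i j) (transpose-comm i j x)) (transpose-inverse i j)

transpose-injective : (i j : Fin m) → IsInjective (transpose i j)
transpose-injective i j x y τx≡τy =
  trans (sym (transpose-involutive i j x)) (trans (cong (transpose i j) τx≡τy) (transpose-involutive i j y))

∘-injective : (f g : Fin m → Fin m) → IsInjective f → IsInjective g → IsInjective (f ∘ g)
∘-injective f g f-inj g-inj x y fgx≡fgy = g-inj x y (f-inj (g x) (g y) fgx≡fgy)

transpose-conjugate : {i i′ j : Fin m} → i ≢ i′ → i′ ≢ j → i ≢ j →
  transpose i j ≗ transpose i i′ ∘ transpose i′ j ∘ transpose i i′
transpose-conjugate {i = i} {i′} {j} i≢i′ i′≢j i≢j x = go (x ≟ i) (x ≟ i′) (x ≟ j)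
  where
  go : Dec (x ≡ i) → Dec (x ≡ i′) → Dec (x ≡ j) →
    transpose i j x ≡ transpose i i′ (transpose i′ j (transpose i i′ x))
  go (yes refl) _ _
    rewrite transpose-ij x j | transpose-ij x i′ | transpose-ij i′ j
    = sym (transpose-fix x i′ (i≢j ∘ sym) (i′≢j ∘ sym))
  go (no _) (yes refl) _
    rewrite transpose-ji i x | transpose-fix x j i≢i′ i≢j | transpose-ij i x
    = transpose-fix i j (i≢i′ ∘ sym) i′≢j
  go (no _) (no _) (yes refl)
    rewrite transpose-ji i x | transpose-fix i i′ (i≢j ∘ sym) (i′≢j ∘ sym) | transpose-ji i′ x
    = sym (transpose-ji i i′)
  go (no x≢i) (no x≢i′) (no x≢j)
    rewrite transpose-fix i j x≢i x≢j | transpose-fix i i′ x≢i x≢i′ | transpose-fix i′ j x≢i′ x≢j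
    = sym (transpose-fix i i′ x≢i x≢i′)

∘transpose≗ : (g : Fin m → A) {i j : Fin m} → g i ≡ g j → g ∘ transpose i j ≗ g
∘transpose≗ g {i} {j} gi≡gj x = go (x ≟ i) (x ≟ j)
  where
  go : Dec (x ≡ i) → Dec (x ≡ j) → g (transpose i j x) ≡ g x
  go (yes refl) _          = trans (cong g (transpose-ij x j)) (sym gi≡gj)
  go (no _)     (yes refl) = trans (cong g (transpose-ji i x)) gi≡gj
  go (no x≢i)   (no x≢j)   = cong g (transpose-fix i j x≢i x≢j)

injective⇒surjective : (f : Fin m → Fin m) → IsInjective f → ∀ y → ∃ λ x → f x ≡ y
injective⇒surjective {suc m} f f-inj y with any? (λ x → f x ≟ y)
... | yes hit = hit
... | no miss with pigeonhole (ℕₚ.n<1+n m) (λ x → punchOut {i = y} {j = f x} (miss ∘ (x ,_) ∘ sym))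
...   | i , j , i<j , collision = ⊥-elim (ℕₚ.<-irrefl (cong toℕ i≡j) i<j)
  where
  i≡j : i ≡ j
  i≡j = f-inj i j (punchOut-injective (miss ∘ (i ,_) ∘ sym) (miss ∘ (j ,_) ∘ sym) collision)

x+0≡y+1⇒x≡1+y : ∀ {x y} → x + 0 ≡ y + 1 → x ≡ suc y
x+0≡y+1⇒x≡1+y {x} {y} e = trans (sym (ℕₚ.+-identityʳ x)) (trans e (ℕₚ.+-comm y 1))

module AdjacentTransposition {k k′ : Fin m} (k′≡1+k : toℕ k′ ≡ suc (toℕ k)) where

  private
    s : Fin m → Fin m
    s = transpose k k′

  k<k′ : k <ᶠ k′
  k<k′ = subst (toℕ k <_) (sym k′≡1+k) (ℕₚ.n<1+n (toℕ k))

  k≢k′ : k ≢ k′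
  k≢k′ k≡k′ = ℕₚ.<-irrefl (cong toℕ k≡k′) k<k′

  below-k′⇔below-k : {o : Fin m} → o ≢ k → (o <ᶠ k′ ⇔ o <ᶠ k)
  below-k′⇔below-k {o} o≢k = mk⇔
    (λ o<k′ → ℕₚ.≤∧≢⇒< (ℕₚ.≤-pred (subst (suc (toℕ o) ≤_) k′≡1+k o<k′)) (o≢k ∘ toℕ-injective))
    (λ o<k → ℕₚ.<-trans o<k k<k′)

  above-k⇔above-k′ : {o : Fin m} → o ≢ k′ → (k <ᶠ o ⇔ k′ <ᶠ o)
  above-k⇔above-k′ {o} o≢k′ = mk⇔
    (λ k<o → ℕₚ.≤∧≢⇒< (subst (_≤ toℕ o) (sym k′≡1+k) k<o) (λ k′≡o → o≢k′ (toℕ-injective (sym k′≡o))))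
    (λ k′<o → ℕₚ.<-trans k<k′ k′<o)

  -- The correction terms account for the single pair {k, k′} whose order s reverses.
  𝟙-swap : ∀ x y → 𝟙 (s y <ᶠ? s x) + 𝟙 (x ≟ k′) * 𝟙 (y ≟ k) ≡ 𝟙 (y <ᶠ? x) + 𝟙 (x ≟ k) * 𝟙 (y ≟ k′)
  𝟙-swap x y = go (x ≟ k) (x ≟ k′) (y ≟ k) (y ≟ k′)
    where
    kk  = 𝟙-yes (k ≟ k) refl
    k′k′ = 𝟙-yes (k′ ≟ k′) refl
    kk′ = 𝟙-no (k ≟ k′) k≢k′
    k′k = 𝟙-no (k′ ≟ k) (k≢k′ ∘ sym)
    k<k′₁ = 𝟙-yes (k <ᶠ? k′) k<k′
    k′<k₀ = 𝟙-no (k′ <ᶠ? k) (ℕₚ.<-asym k<k′)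
    irrefl : ∀ u → 𝟙 (u <ᶠ? u) ≡ 0
    irrefl u = 𝟙-no (u <ᶠ? u) (ℕₚ.<-irrefl refl)
    go : Dec (x ≡ k) → Dec (x ≡ k′) → Dec (y ≡ k) → Dec (y ≡ k′) →
      𝟙 (s y <ᶠ? s x) + 𝟙 (x ≟ k′) * 𝟙 (y ≟ k) ≡ 𝟙 (y <ᶠ? x) + 𝟙 (x ≟ k) * 𝟙 (y ≟ k′)
    go (yes refl) _ (yes refl) _
      rewrite transpose-ij k k′ | kk | kk′ | irrefl k | irrefl k′ = refl
    go (yes refl) _ (no _) (yes refl)
      rewrite transpose-ij k k′ | transpose-ji k k′ | kk | k′k′ | kk′ | k<k′₁ | k′<k₀ = refl
    go (yes refl) _ (no y≢k) (no y≢k′)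
      rewrite transpose-ij k k′ | transpose-fix k k′ y≢k y≢k′ | kk | kk′
            | 𝟙-no (y ≟ k′) y≢k′
      = cong (_+ 0) (𝟙-⇔ (below-k′⇔below-k y≢k) (y <ᶠ? k′) (y <ᶠ? k))
    go (no _) (yes refl) (yes refl) _
      rewrite transpose-ij k k′ | transpose-ji k k′ | kk | k′k′ | kk′ | k′k | k<k′₁ | k′<k₀ = refl
    go (no _) (yes refl) (no _) (yes refl)
      rewrite transpose-ji k k′ | k′k′ | k′k | irrefl k | irrefl k′ = refl
    go (no _) (yes refl) (no y≢k) (no y≢k′)
      rewrite transpose-ji k k′ | transpose-fix k k′ y≢k y≢k′ | k′k′ | k′k
            | 𝟙-no (y ≟ k) y≢k
      = cong (_+ 0) (𝟙-⇔ (⇔.sym (below-k′⇔below-k y≢k)) (y <ᶠ? k) (y <ᶠ? k′))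
    go (no x≢k) (no x≢k′) (yes refl) _
      rewrite transpose-ij k k′ | transpose-fix k k′ x≢k x≢k′ | 𝟙-no (x ≟ k) x≢k | 𝟙-no (x ≟ k′) x≢k′
      = cong (_+ 0) (𝟙-⇔ (⇔.sym (above-k⇔above-k′ x≢k′)) (k′ <ᶠ? x) (k <ᶠ? x))
    go (no x≢k) (no x≢k′) (no _) (yes refl)
      rewrite transpose-ji k k′ | transpose-fix k k′ x≢k x≢k′ | 𝟙-no (x ≟ k) x≢k | 𝟙-no (x ≟ k′) x≢k′
      = cong (_+ 0) (𝟙-⇔ (above-k⇔above-k′ x≢k′) (k <ᶠ? x) (k′ <ᶠ? x))
    go (no x≢k) (no x≢k′) (no y≢k) (no y≢k′)
      rewrite transpose-fix k k′ x≢k x≢k′ | transpose-fix k k′ y≢k y≢k′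
            | 𝟙-no (x ≟ k) x≢k | 𝟙-no (x ≟ k′) x≢k′ = refl

  module _ (f : Fin m → Fin m) (f-inj : IsInjective f) where

    private
      preimage : Fin m → Fin m
      preimage u = proj₁ (injective⇒surjective f f-inj u)

      f∘preimage : ∀ u → f (preimage u) ≡ u
      f∘preimage u = proj₂ (injective⇒surjective f f-inj u)

      preimage-unique : ∀ u x → f x ≡ u → x ≡ preimage u
      preimage-unique u x fx≡u = f-inj x (preimage u) (trans fx≡u (sym (f∘preimage u)))

      pairs : Fin m → Fin m → Fin m → Fin m → ℕ
      pairs u v i j = 𝟙 (f j ≟ v) * (𝟙 (f i ≟ u) * 𝟙 (i <ᶠ? j))

      sum₂-pairs : ∀ u v → sum₂ (pairs u v) ≡ 𝟙 (preimage u <ᶠ? preimage v)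
      sum₂-pairs u v = trans
        (sum-cong-≗ λ i → sum-𝟙*-unique (λ j → f j ≟ v) (f∘preimage v) (preimage-unique v)
                                        (λ j → 𝟙 (f i ≟ u) * 𝟙 (i <ᶠ? j)))
        (sum-𝟙*-unique (λ i → f i ≟ u) (f∘preimage u) (preimage-unique u) (λ i → 𝟙 (i <ᶠ? preimage v)))

      inversion-pairs : Fin m → Fin m → (Fin m → Fin m) → ℕ
      inversion-pairs i j h = 𝟙 (i <ᶠ? j) * 𝟙 (h j <ᶠ? h i)

      distribute : ∀ c a x y → c * (a + x * y) ≡ c * a + y * (x * c)
      distribute = solve-∀

      inversion-pairs-swap : ∀ i j →
        inversion-pairs i j (s ∘ f) + pairs k′ k i j ≡ inversion-pairs i j f + pairs k k′ i j
      inversion-pairs-swap i j = begin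
        c * 𝟙 (s (f j) <ᶠ? s (f i)) + pairs k′ k i j
          ≡⟨ distribute c (𝟙 (s (f j) <ᶠ? s (f i))) (𝟙 (f i ≟ k′)) (𝟙 (f j ≟ k)) ⟨
        c * (𝟙 (s (f j) <ᶠ? s (f i)) + 𝟙 (f i ≟ k′) * 𝟙 (f j ≟ k))
          ≡⟨ cong (c *_) (𝟙-swap (f i) (f j)) ⟩
        c * (𝟙 (f j <ᶠ? f i) + 𝟙 (f i ≟ k) * 𝟙 (f j ≟ k′))
          ≡⟨ distribute c (𝟙 (f j <ᶠ? f i)) (𝟙 (f i ≟ k)) (𝟙 (f j ≟ k′)) ⟩
        c * 𝟙 (f j <ᶠ? f i) + pairs k k′ i j ∎
        where
        open ≡-Reasoning
        c = 𝟙 (i <ᶠ? j)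

    inversions-swap : inversions (s ∘ f) + 𝟙 (preimage k′ <ᶠ? preimage k)
                    ≡ inversions f + 𝟙 (preimage k <ᶠ? preimage k′)
    inversions-swap = begin
      inversions (s ∘ f) + 𝟙 (preimage k′ <ᶠ? preimage k)
        ≡⟨ cong₂ _+_ (inversions≡sum₂ (s ∘ f)) (sym (sum₂-pairs k′ k)) ⟩
      sum₂ (λ i j → inversion-pairs i j (s ∘ f)) + sum₂ (pairs k′ k)
        ≡⟨ sum₂-+ (λ i j → inversion-pairs i j (s ∘ f)) (pairs k′ k) ⟨
      sum₂ (λ i j → inversion-pairs i j (s ∘ f) + pairs k′ k i j)
        ≡⟨ sum₂-cong inversion-pairs-swap ⟩
      sum₂ (λ i j → inversion-pairs i j f + pairs k k′ i j)
        ≡⟨ sum₂-+ (λ i j → inversion-pairs i j f) (pairs k k′) ⟩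
      sum₂ (λ i j → inversion-pairs i j f) + sum₂ (pairs k k′)
        ≡⟨ cong₂ _+_ (sym (inversions≡sum₂ f)) (sum₂-pairs k k′) ⟩
      inversions f + 𝟙 (preimage k <ᶠ? preimage k′) ∎
      where open ≡-Reasoning

    sgn-swap : sgn (s ∘ f) ≡ - sgn f
    sgn-swap with <-cmp (preimage k) (preimage k′) | inversions-swap
    ... | tri< p<q _ ¬q<p | eq
      rewrite 𝟙-no (preimage k′ <ᶠ? preimage k) ¬q<p | 𝟙-yes (preimage k <ᶠ? preimage k′) p<q
      = cong negPow (x+0≡y+1⇒x≡1+y eq)
    ... | tri≈ _ p≡q _ | _ = ⊥-elim (k≢k′ (trans (sym (f∘preimage k)) (trans (cong f p≡q) (f∘preimage k′))))
    ... | tri> ¬p<q _ q<p | eq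
      rewrite 𝟙-yes (preimage k′ <ᶠ? preimage k) q<p | 𝟙-no (preimage k <ᶠ? preimage k′) ¬p<q
      = trans (sym (ℤₚ.neg-involutive _)) (cong -_ (sym (cong negPow (x+0≡y+1⇒x≡1+y (sym eq)))))

sgn-transpose-at-distance : ∀ d (i j : Fin m) → toℕ j ≡ suc (d + toℕ i) →
  (f : Fin m → Fin m) → IsInjective f → sgn (transpose i j ∘ f) ≡ - sgn f
sgn-transpose-at-distance zero    i j j≡1+i f f-inj = AdjacentTransposition.sgn-swap j≡1+i f f-inj
sgn-transpose-at-distance {m} (suc d) i j j≡2+d+i f f-inj = begin
  sgn (transpose i j ∘ f)
    ≡⟨ sgn-cong (transpose-conjugate i≢i′ i′≢j i≢j ∘ f) ⟩
  sgn (s ∘ (transpose i′ j ∘ (s ∘ f)))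
    ≡⟨ AdjacentTransposition.sgn-swap i′≡1+i (transpose i′ j ∘ (s ∘ f))
                                      (∘-injective _ _ (transpose-injective i′ j) s∘f-inj) ⟩
  - sgn (transpose i′ j ∘ (s ∘ f))
    ≡⟨ cong -_ (sgn-transpose-at-distance d i′ j j≡1+d+i′ (s ∘ f) s∘f-inj) ⟩
  - - sgn (s ∘ f)
    ≡⟨ ℤₚ.neg-involutive _ ⟩
  sgn (s ∘ f)
    ≡⟨ AdjacentTransposition.sgn-swap i′≡1+i f f-inj ⟩
  - sgn f ∎
  where
  open ≡-Reasoning
  1+i<m : suc (toℕ i) < m
  1+i<m = ℕₚ.≤-<-trans (subst (suc (toℕ i) ≤_) (sym j≡2+d+i) (s≤s (ℕₚ.m≤n+m (toℕ i) (suc d)))) (toℕ<n j)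
  i′ : Fin m
  i′ = fromℕ< 1+i<m
  i′≡1+i : toℕ i′ ≡ suc (toℕ i)
  i′≡1+i = toℕ-fromℕ< 1+i<m
  s : Fin m → Fin m
  s = transpose i i′
  s∘f-inj : IsInjective (s ∘ f)
  s∘f-inj = ∘-injective s f (transpose-injective i i′) f-inj
  j≡1+d+i′ : toℕ j ≡ suc (d + toℕ i′)
  j≡1+d+i′ = trans j≡2+d+i (cong suc (trans (sym (ℕₚ.+-suc d (toℕ i))) (cong (_+_ d) (sym i′≡1+i))))
  i′<j : toℕ i′ < toℕ j
  i′<j = subst (toℕ i′ <_) (sym j≡1+d+i′) (s≤s (ℕₚ.m≤n+m (toℕ i′) d))
  i<i′ : toℕ i < toℕ i′
  i<i′ = subst (toℕ i <_) (sym i′≡1+i) (ℕₚ.n<1+n (toℕ i))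
  i≢i′ : i ≢ i′
  i≢i′ i≡i′ = ℕₚ.<-irrefl (cong toℕ i≡i′) i<i′
  i′≢j : i′ ≢ j
  i′≢j i′≡j = ℕₚ.<-irrefl (cong toℕ i′≡j) i′<j
  i≢j : i ≢ j
  i≢j i≡j = ℕₚ.<-irrefl (cong toℕ i≡j) (ℕₚ.<-trans i<i′ i′<j)

sgn-transpose-< : {i j : Fin m} → i <ᶠ j → (f : Fin m → Fin m) → IsInjective f →
  sgn (transpose i j ∘ f) ≡ - sgn f
sgn-transpose-< {i = i} {j} i<j =
  sgn-transpose-at-distance (toℕ j ∸ suc (toℕ i)) i j (trans (sym (ℕₚ.m∸n+n≡m i<j)) (ℕₚ.+-suc _ _))

sgn-transpose-∘ : (i j : Fin m) → i ≢ j → (f : Fin m → Fin m) → IsInjective f →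
  sgn (transpose i j ∘ f) ≡ - sgn f
sgn-transpose-∘ i j i≢j f f-inj with <-cmp i j
... | tri< i<j _ _ = sgn-transpose-< i<j f f-inj
... | tri≈ _ i≡j _ = ⊥-elim (i≢j i≡j)
... | tri> _ _ j<i = trans (sgn-cong (transpose-comm i j ∘ f)) (sgn-transpose-< j<i f f-inj)

-- Signed sums over enumerations

sumOver : List A → (A → ℤ) → ℤ
sumOver xs h = foldr (λ x acc → h x ℤ.+ acc) (+ 0) xs

sumOver-cong : (xs : List A) {h h′ : A → ℤ} → (∀ x → h x ≡ h′ x) → sumOver xs h ≡ sumOver xs h′
sumOver-cong []       h≗h′ = refl
sumOver-cong (x ∷ xs) h≗h′ = cong₂ ℤ._+_ (h≗h′ x) (sumOver-cong xs h≗h′)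

sumOver-cong-All : (xs : List A) {h h′ : A → ℤ} → All (λ x → h x ≡ h′ x) xs → sumOver xs h ≡ sumOver xs h′
sumOver-cong-All []       []            = refl
sumOver-cong-All (x ∷ xs) (hx≡h′x ∷ hs) = cong₂ ℤ._+_ hx≡h′x (sumOver-cong-All xs hs)

sumOver-neg : (xs : List A) (h : A → ℤ) → sumOver xs (-_ ∘ h) ≡ - sumOver xs h
sumOver-neg []       h = refl
sumOver-neg (x ∷ xs) h = trans (cong (λ s → - h x ℤ.+ s) (sumOver-neg xs h)) (sym (ℤₚ.neg-distrib-+ (h x) _))

sumOver-++ : (xs ys : List A) (h : A → ℤ) → sumOver (xs ++ ys) h ≡ sumOver xs h ℤ.+ sumOver ys h
sumOver-++ []       ys h = sym (ℤₚ.+-identityˡ _)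
sumOver-++ (x ∷ xs) ys h = trans (cong (λ s → h x ℤ.+ s) (sumOver-++ xs ys h)) (sym (ℤₚ.+-assoc (h x) _ _))

sumOver-map : (g : A → B) (xs : List A) (h : B → ℤ) → sumOver (map g xs) h ≡ sumOver xs (h ∘ g)
sumOver-map g []       h = refl
sumOver-map g (x ∷ xs) h = cong (λ s → h (g x) ℤ.+ s) (sumOver-map g xs h)

sumOver-concatMap-map : (D : A → B → C) (xs : List A) (ys : List B) (h : C → ℤ) →
  sumOver (concatMap (λ x → map (D x) ys) xs) h ≡ sumOver xs (λ x → sumOver ys (h ∘ D x))
sumOver-concatMap-map D []       ys h = refl
sumOver-concatMap-map D (x ∷ xs) ys h =
  trans (sumOver-++ (map (D x) ys) _ h) (cong₂ ℤ._+_ (sumOver-map (D x) ys h) (sumOver-concatMap-map D xs ys h))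

sumOver-filter : {P : A → Set p} (P? : ∀ x → Dec (P x)) (xs : List A) (h : A → ℤ) →
  sumOver (filter P? xs) h ≡ sumOver xs (λ x → if does (P? x) then h x else + 0)
sumOver-filter P? []       h = refl
sumOver-filter P? (x ∷ xs) h with does (P? x)
... | true  = cong (λ s → h x ℤ.+ s) (sumOver-filter P? xs h)
... | false = trans (sumOver-filter P? xs h) (sym (ℤₚ.+-identityˡ _))

sumOver-allFin : (h : Fin m → ℤ) → sumOver (allFin m) h ≡ sumℤ h
sumOver-allFin h = foldr-tabulate ℤ._+_ (+ 0) h id

i≡-i⇒i≡0 : {i : ℤ} → i ≡ - i → i ≡ + 0
i≡-i⇒i≡0 {+ zero}   _  = refl
i≡-i⇒i≡0 {+[1+ _ ]} ()
i≡-i⇒i≡0 { -[1+ _ ]} ()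

module _ {A : Set a} (_≈_ : Rel A ℓ) where

  -- Enumerated permutations are functions, so without extensionality they can only be
  -- compared pointwise: summands must respect that comparison.
  SumInvariant : (A → A) → List A → Set (a ⊔ ℓ)
  SumInvariant σ xs = ∀ (h : A → ℤ) → h Preserves _≈_ ⟶ _≡_ → sumOver xs (h ∘ σ) ≡ sumOver xs h

  id-sumInvariant : (xs : List A) → SumInvariant id xs
  id-sumInvariant xs h h-cong = refl

  sign-reversing-sum≡0 : {σ : A → A} {xs : List A} → SumInvariant σ xs →
    (h : A → ℤ) → h Preserves _≈_ ⟶ _≡_ → All (λ x → h (σ x) ≡ - h x) xs → sumOver xs h ≡ + 0
  sign-reversing-sum≡0 {σ} {xs} σ-inv h h-cong h∘σ≡-h = i≡-i⇒i≡0 (begin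
    sumOver xs h          ≡⟨ σ-inv h h-cong ⟨
    sumOver xs (h ∘ σ)    ≡⟨ sumOver-cong-All xs h∘σ≡-h ⟩
    sumOver xs (-_ ∘ h)   ≡⟨ sumOver-neg xs h ⟩
    - sumOver xs h        ∎)
    where open ≡-Reasoning

  filter-sumInvariant : {σ : A → A} {xs : List A} {P : A → Set p} (P? : ∀ x → Dec (P x)) →
    (∀ {x y} → x ≈ y → P x ⇔ P y) → (∀ x → P (σ x) ⇔ P x) →
    SumInvariant σ xs → SumInvariant σ (filter P? xs)
  filter-sumInvariant {σ = σ} {xs} P? P-cong P∘σ σ-inv h h-cong = begin
    sumOver (filter P? xs) (h ∘ σ)
      ≡⟨ sumOver-filter P? xs (h ∘ σ) ⟩
    sumOver xs (λ x → if does (P? x) then h (σ x) else + 0)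
      ≡⟨ sumOver-cong xs (λ x → cong (λ b → if b then h (σ x) else + 0) (does-⇔ (P∘σ x) (P? (σ x)) (P? x))) ⟨
    sumOver xs (hₚ ∘ σ)
      ≡⟨ σ-inv hₚ (λ {x} {y} x≈y → cong₂ (λ b z → if b then z else + 0)
                                         (does-⇔ (P-cong x≈y) (P? x) (P? y)) (h-cong x≈y)) ⟩
    sumOver xs hₚ
      ≡⟨ sumOver-filter P? xs h ⟨
    sumOver (filter P? xs) h ∎
    where
    open ≡-Reasoning
    hₚ : A → ℤ
    hₚ x = if does (P? x) then h x else + 0

concatMap-sumInvariant : {_≈ᴬ_ : Rel A ℓ₁} {_≈ᴮ_ : Rel B ℓ₂} {_≈ᶜ_ : Rel C ℓ₃}
  {σᴬ : A → A} {σᴮ : B → B} {σᶜ : C → C} {xs : List A} {ys : List B} (D : A → B → C) →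
  (∀ x y → σᶜ (D x y) ≈ᶜ D (σᴬ x) (σᴮ y)) →
  (∀ {x x′} y → x ≈ᴬ x′ → D x y ≈ᶜ D x′ y) →
  (∀ x {y y′} → y ≈ᴮ y′ → D x y ≈ᶜ D x y′) →
  SumInvariant _≈ᴬ_ σᴬ xs → SumInvariant _≈ᴮ_ σᴮ ys →
  SumInvariant _≈ᶜ_ σᶜ (concatMap (λ x → map (D x) ys) xs)
concatMap-sumInvariant {σᴬ = σᴬ} {σᴮ} {σᶜ} {xs} {ys} D D-σ D-congˡ D-congʳ σᴬ-inv σᴮ-inv h h-cong = begin
  sumOver (concatMap (λ x → map (D x) ys) xs) (h ∘ σᶜ)
    ≡⟨ sumOver-concatMap-map D xs ys (h ∘ σᶜ) ⟩
  sumOver xs (λ x → sumOver ys (λ y → h (σᶜ (D x y))))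
    ≡⟨ sumOver-cong xs (λ x → sumOver-cong ys (λ y → h-cong (D-σ x y))) ⟩
  sumOver xs (λ x → sumOver ys (λ y → h (D (σᴬ x) (σᴮ y))))
    ≡⟨ sumOver-cong xs (λ x → σᴮ-inv (h ∘ D (σᴬ x)) (h-cong ∘ D-congʳ (σᴬ x))) ⟩
  sumOver xs (λ x → sumOver ys (h ∘ D (σᴬ x)))
    ≡⟨ σᴬ-inv (λ x → sumOver ys (h ∘ D x)) (λ x≈x′ → sumOver-cong ys (λ y → h-cong (D-congˡ y x≈x′))) ⟩
  sumOver xs (λ x → sumOver ys (h ∘ D x))
    ≡⟨ sumOver-concatMap-map D xs ys h ⟨
  sumOver (concatMap (λ x → map (D x) ys) xs) h ∎
  where open ≡-Reasoning

allFin-sumInvariant : (i j : Fin m) → SumInvariant _≡_ (transpose i j) (allFin m)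
allFin-sumInvariant i j h h-cong = begin
  sumOver (allFin _) (h ∘ transpose i j) ≡⟨ sumOver-allFin (h ∘ transpose i j) ⟩
  sumℤ (h ∘ transpose i j)               ≡⟨ sumℤ-permute h (Permutation.transpose i j) ⟨
  sumℤ h                                 ≡⟨ sumOver-allFin h ⟨
  sumOver (allFin _) h                   ∎
  where open ≡-Reasoning

allFuns-sumInvariant : ∀ m′ (i j : Fin m) → SumInvariant _≗_ (transpose i j ∘_) (allFuns m′ m)
allFuns-sumInvariant zero     i j h h-cong = cong (λ s → s ℤ.+ + 0) (h-cong λ ())
allFuns-sumInvariant {m} (suc m′) i j = concatMap-sumInvariant
  {σᴬ = transpose i j ∘_} {σᴮ = transpose i j} {σᶜ = transpose i j ∘_} {xs = allFuns m′ m} {ys = allFin m} _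
  (λ f x → λ { zero → refl ; (suc _) → refl })
  (λ x f≗f′ → λ { zero → refl ; (suc r) → f≗f′ r })
  (λ { f refl _ → refl })
  (allFuns-sumInvariant m′ i j) (allFin-sumInvariant i j)

perms-sumInvariant : (i j : Fin m) → SumInvariant _≗_ (transpose i j ∘_) (perms m)
perms-sumInvariant {m} i j = filter-sumInvariant _≗_ {xs = allFuns m m} injective?
  (λ f≗f′ → mk⇔ (λ f-inj x y f′x≡f′y → f-inj x y (trans (f≗f′ x) (trans f′x≡f′y (sym (f≗f′ y)))))
                (λ f′-inj x y fx≡fy → f′-inj x y (trans (sym (f≗f′ x)) (trans fx≡fy (f≗f′ y)))))
  (λ f → mk⇔ (λ τf-inj x y fx≡fy → τf-inj x y (cong (transpose i j) fx≡fy))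
             (∘-injective (transpose i j) f (transpose-injective i j)))
  (allFuns-sumInvariant m i j)

Tuple : (k : ℕ) → (Fin k → ℕ) → Set
Tuple k ζ = (c : Fin k) → Fin (ζ c) → Fin (ζ c)

_≐_ : {ζ : Fin k → ℕ} → Tuple k ζ → Tuple k ζ → Set
t ≐ t′ = ∀ c → t c ≗ t′ c

updateAt : {X : Fin k → Set a} (c : Fin k) → (X c → X c) → ((c′ : Fin k) → X c′) → (c′ : Fin k) → X c′
updateAt zero    g t zero     = g (t zero)
updateAt zero    g t (suc c′) = t (suc c′)
updateAt (suc c) g t zero     = t zero
updateAt (suc c) g t (suc c′) = updateAt c g (t ∘ suc) c′

updateAt-updates : {X : Fin k → Set a} (c : Fin k) (g : X c → X c) (t : (c′ : Fin k) → X c′) →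
  updateAt c g t c ≡ g (t c)
updateAt-updates zero    g t = refl
updateAt-updates (suc c) g t = updateAt-updates c g (t ∘ suc)

updateAt-minimal : {X : Fin k → Set a} (c : Fin k) (g : X c → X c) (t : (c′ : Fin k) → X c′) →
  ∀ {c′} → c′ ≢ c → updateAt c g t c′ ≡ t c′
updateAt-minimal zero    g t {zero}   c′≢c = ⊥-elim (c′≢c refl)
updateAt-minimal zero    g t {suc c′} c′≢c = refl
updateAt-minimal (suc c) g t {zero}   c′≢c = refl
updateAt-minimal (suc c) g t {suc c′} c′≢c = updateAt-minimal c g (t ∘ suc) (c′≢c ∘ cong suc)

product-updateAt : {X : Fin k → Set a} (w : ∀ c → X c → ℤ) (c : Fin k) (g : X c → X c)
  (t : (c′ : Fin k) → X c′) → w c (g (t c)) ≡ - w c (t c) →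
  product (λ c′ → w c′ (updateAt c g t c′)) ≡ - product (λ c′ → w c′ (t c′))
product-updateAt w zero g t w-flips =
  trans (cong (ℤ._* rest) w-flips) (sym (ℤₚ.neg-distribˡ-* (w zero (t zero)) rest))
  where rest = product (λ c′ → w (suc c′) (t (suc c′)))
product-updateAt w (suc c) g t w-flips =
  trans (cong (w zero (t zero) ℤ.*_) (product-updateAt (w ∘ suc) c g (t ∘ suc) w-flips))
        (sym (ℤₚ.neg-distribʳ-* (w zero (t zero)) (product (λ c′ → w (suc c′) (t (suc c′))))))

All-concatMap-map⁺ : {P : C → Set p} (D : A → B → C) {xs : List A} {ys : List B} →
  All (λ x → All (λ y → P (D x y)) ys) xs → All P (concatMap (λ x → map (D x) ys) xs)
All-concatMap-map⁺ D = Allₚ.concat⁺ ∘ Allₚ.map⁺ ∘ All.map Allₚ.map⁺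

tuples-injective : ∀ k (ζ : Fin k → ℕ) → All (λ t → ∀ c → IsInjective (t c)) (tuples k ζ)
tuples-injective zero    ζ = (λ ()) ∷ []
tuples-injective (suc k) ζ = All-concatMap-map⁺ _
  (All.map (λ p-inj → All.map (λ t-inj → λ { zero → p-inj ; (suc c) → t-inj c }) (tuples-injective k (ζ ∘ suc)))
           (Allₚ.all-filter injective? (allFuns (ζ zero) (ζ zero))))

tuples-sumInvariant : ∀ k (ζ : Fin k → ℕ) (c : Fin k) (i j : Fin (ζ c)) →
  SumInvariant _≐_ (updateAt c (transpose i j ∘_)) (tuples k ζ)
tuples-sumInvariant (suc k) ζ zero i j = concatMap-sumInvariant
  {_≈ᴮ_ = _≐_} {σᴬ = transpose i j ∘_} {σᴮ = id} {σᶜ = updateAt zero (transpose i j ∘_)}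
  {xs = perms (ζ zero)} {ys = tuples k (ζ ∘ suc)} _
  (λ p t → λ { zero r → refl ; (suc c) r → refl })
  (λ t p≗p′ → λ { zero r → p≗p′ r ; (suc c) r → refl })
  (λ p t≐t′ → λ { zero r → refl ; (suc c) r → t≐t′ c r })
  (perms-sumInvariant i j) (id-sumInvariant _≐_ (tuples k (ζ ∘ suc)))
tuples-sumInvariant (suc k) ζ (suc c) i j = concatMap-sumInvariant
  {_≈ᴬ_ = _≗_} {σᴬ = id} {σᴮ = updateAt c (transpose i j ∘_)} {σᶜ = updateAt (suc c) (transpose i j ∘_)}
  {xs = perms (ζ zero)} {ys = tuples k (ζ ∘ suc)} _
  (λ p t → λ { zero r → refl ; (suc c) r → refl })
  (λ t p≗p′ → λ { zero r → p≗p′ r ; (suc c) r → refl })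
  (λ p t≐t′ → λ { zero r → refl ; (suc c) r → t≐t′ c r })
  (id-sumInvariant _≗_ (perms (ζ zero))) (tuples-sumInvariant k (ζ ∘ suc) c i j)

-- The signed sum R(F, S)

module _ {n : ℕ} {λ′ : Partition} where

  _≋_ : Filling n λ′ → Filling n λ′ → Set
  G ≋ G′ = ∀ c → G c ≗ G′ c

  entry-cong : {G G′ : Filling n λ′} → G ≋ G′ → ∀ r c → entry {n} {λ′} G r c ≡ entry {n} {λ′} G′ r c
  entry-cong {G} {G′} G≋G′ r c with r ℕ.<? col λ′ c
  ... | yes r<ζ = cong just (G≋G′ c (fromℕ< r<ζ))
  ... | no  _   = refl

  rowCount-cong : {G G′ : Filling n λ′} → G ≋ G′ → ∀ r v → rowCount {n} {λ′} G r v ≡ rowCount {n} {λ′} G′ r v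
  rowCount-cong {G} {G′} G≋G′ r v = begin
    rowCount {n} {λ′} G r v
      ≡⟨ length-filter-tabulate (λ c → ≡-dec _≟_ (entry {n} {λ′} G r c) (just v)) id ⟩
    sum (λ c → 𝟙 (≡-dec _≟_ (entry {n} {λ′} G r c) (just v)))
      ≡⟨ sum-cong-≗ (λ c → cong (λ e → 𝟙 (≡-dec _≟_ e (just v))) (entry-cong G≋G′ r c)) ⟩
    sum (λ c → 𝟙 (≡-dec _≟_ (entry {n} {λ′} G′ r c) (just v)))
      ≡⟨ length-filter-tabulate (λ c → ≡-dec _≟_ (entry {n} {λ′} G′ r c) (just v)) id ⟨
    rowCount {n} {λ′} G′ r v ∎
    where open ≡-Reasoning

  sameRowContent?-cong : {G G′ : Filling n λ′} → G ≋ G′ → (S : Filling n λ′) →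
    ⌊ sameRowContent? {n} {λ′} G S ⌋ ≡ ⌊ sameRowContent? {n} {λ′} G′ S ⌋
  sameRowContent?-cong {G} {G′} G≋G′ S = begin
    ⌊ sameRowContent? G S ⌋   ≡⟨ isYes≗does (sameRowContent? G S) ⟩
    does (sameRowContent? G S)  ≡⟨ does-⇔ (mk⇔ (λ same r v → trans (sym (rowCount-cong G≋G′ (toℕ r) v)) (same r v))
                                                (λ same r v → trans (rowCount-cong G≋G′ (toℕ r) v) (same r v)))
                                           (sameRowContent? G S) (sameRowContent? G′ S) ⟩
    does (sameRowContent? G′ S) ≡⟨ isYes≗does (sameRowContent? G′ S) ⟨
    ⌊ sameRowContent? G′ S ⌋   ∎
    where open ≡-Reasoning

  sgnᶜ≡product : (π : ColPerm λ′) → sgnᶜ {λ′} π ≡ product (λ c → sgn (π c))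
  sgnᶜ≡product π = foldr-tabulate ℤ._*_ (+ 1) (λ c → sgn (π c)) id

  -- R F S unfolds definitionally to sumOver (allColPerms λ′) (summand F S).
  summand : Filling n λ′ → Filling n λ′ → ColPerm λ′ → ℤ
  summand F S π = if ⌊ sameRowContent? {n} {λ′} (act {n} {λ′} F π) S ⌋ then sgnᶜ {λ′} π else + 0

  summand-cong : (F S : Filling n λ′) → summand F S Preserves _≐_ ⟶ _≡_
  summand-cong F S {π} {π′} π≐π′ = cong₂ (λ b x → if b then x else + 0)
    (sameRowContent?-cong (λ c r → cong (F c) (π≐π′ c r)) S)
    (begin
      sgnᶜ {λ′} π                ≡⟨ sgnᶜ≡product π ⟩
      product (λ c → sgn (π c))  ≡⟨ product-cong-≗ (λ c → sgn-cong (π≐π′ c)) ⟩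
      product (λ c → sgn (π′ c)) ≡⟨ sgnᶜ≡product π′ ⟨
      sgnᶜ {λ′} π′               ∎)
    where open ≡-Reasoning

  act-updateAt : (F : Filling n λ′) (c : Fin (ncols λ′)) (τ : Fin (col λ′ c) → Fin (col λ′ c)) →
    F c ∘ τ ≗ F c → (π : ColPerm λ′) → act {n} {λ′} F (updateAt c (τ ∘_) π) ≋ act {n} {λ′} F π
  act-updateAt F c τ Fτ≗F π c′ r with c′ ≟ c
  ... | yes refl = trans (cong (λ p → F c (p r)) (updateAt-updates c (τ ∘_) π)) (Fτ≗F (π c r))
  ... | no c′≢c  = cong (λ p → F c′ (p r)) (updateAt-minimal c (τ ∘_) π c′≢c)

  summand-updateAt : (F S : Filling n λ′) (c : Fin (ncols λ′)) (τ : Fin (col λ′ c) → Fin (col λ′ c)) →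
    F c ∘ τ ≗ F c → (π : ColPerm λ′) → sgn (τ ∘ π c) ≡ - sgn (π c) →
    summand F S (updateAt c (τ ∘_) π) ≡ - summand F S π
  summand-updateAt F S c τ Fτ≗F π sgn-flips
    rewrite sameRowContent?-cong (act-updateAt F c τ Fτ≗F π) S
    with ⌊ sameRowContent? {n} {λ′} (act {n} {λ′} F π) S ⌋
  ... | false = refl
  ... | true  = begin
    sgnᶜ {λ′} (updateAt c (τ ∘_) π)                ≡⟨ sgnᶜ≡product (updateAt c (τ ∘_) π) ⟩
    product (λ c′ → sgn (updateAt c (τ ∘_) π c′))  ≡⟨ product-updateAt (λ _ → sgn) c (τ ∘_) π sgn-flips ⟩
    - product (λ c′ → sgn (π c′))                 ≡⟨ cong -_ (sgnᶜ≡product π) ⟨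
    - sgnᶜ {λ′} π                                 ∎
    where open ≡-Reasoning

-- Neither the content of F and S nor n ≥ 2 is needed: a repeated entry in a column suffices.
corollary3p14 : (n : ℕ) → 2 ≤ n → (λ' : Partition) (z : Content n) → ∣ z ∣ᶜ ≡ size λ' →
    (F S : Filling n λ') → HasContent {n} {λ'} F z → HasContent {n} {λ'} S z →
    HasRepeatInColumn {n} {λ'} F → R {n} {λ'} F S ≡ + 0
corollary3p14 n _ λ' z _ F S _ _ (c , i , j , i≢j , Fci≡Fcj) =
  sign-reversing-sum≡0 _≐_ (tuples-sumInvariant (ncols λ') (col λ') c i j) (summand F S) (summand-cong F S)
    (All.map (λ {π} π-inj → summand-updateAt F S c (transpose i j) (∘transpose≗ (F c) Fci≡Fcj) π
                              (sgn-transpose-∘ i j i≢j (π c) (π-inj c)))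
             (tuples-injective (ncols λ') (col λ')))
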